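{- Let $C$ be a symmetric orthogonal signed matrix of order $n$. Let $H$ be the $4n\times 4n$ matrix $$H=\begin{pmatrix} A_1 & A_2 & A_3 & A_4\\ -A_2 & A_1 & -A_4 & A_3\\ -A_3 & A_4 & A_1 & -A_2\\ -A_4 & -A_3 & A_2 & A_1\end{pmatrix},$$ where $(A_1,A_2,A_3,A_4)$ is one of the following: (i) $A_1=A_2=A_3=A_4=C$; (ii) $A_1=A_2=C$, $A_3=C-I$, $A_4=C+I$, provided $C$ has zero diagonal; (iii) $A_1=A_2=C+I$, $A_3=A_4=C-I$, provided $C$ has zero diagonal. Then $H$ is an orthogonal signed matrix.
   Context: An $m\times m$ matrix $C$ is an orthogonal signed matrix if its entries lie in $\{0,1,-1\}$ and $CC^t=C^tC=\alpha I_m$ for some positive integer $\alpha$. Here $I=I_n$. -}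

module Defs where

open import Data.Nat using (ℕ; zero; suc)
import Data.Nat as ℕ
open import Data.Fin using (Fin; zero; suc; remQuot)
open import Data.Integer using (ℤ; +_; -_; _+_; _*_; _-_; 0ℤ; 1ℤ; -1ℤ; _>_)
open import Data.Product using (_×_; _,_; ∃)
open import Data.Sum using (_⊎_)
open import Relation.Binary.PropositionalEquality using (_≡_)

Matrix : ℕ → Set
Matrix m = Fin m → Fin m → ℤ

Σ : (m : ℕ) → (Fin m → ℤ) → ℤ
Σ zero    f = 0ℤ
Σ (suc m) f = f zero + Σ m (λ i → f (suc i))

transpose : ∀ {m} → Matrix m → Matrix m
transpose A i j = A j i

_·_ : ∀ {m} → Matrix m → Matrix m → Matrix m
_·_ {m} A B i j = Σ m (λ k → A i k * B k j)

δ : ∀ {m} → Fin m → Fin m → ℤ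
δ zero    zero    = 1ℤ
δ zero    (suc j) = 0ℤ
δ (suc i) zero    = 0ℤ
δ (suc i) (suc j) = δ i j

I : ∀ {m} → Matrix m
I = δ

_•_ : ∀ {m} → ℤ → Matrix m → Matrix m
(α • A) i j = α * A i j

_⊕_ : ∀ {m} → Matrix m → Matrix m → Matrix m
(A ⊕ B) i j = A i j + B i j

_⊖_ : ∀ {m} → Matrix m → Matrix m → Matrix m
(A ⊖ B) i j = A i j - B i j

neg : ∀ {m} → Matrix m → Matrix m
neg A i j = - A i j

Signed : ∀ {m} → Matrix m → Set
Signed {m} C = ∀ i j → (C i j ≡ 0ℤ) ⊎ ((C i j ≡ 1ℤ) ⊎ (C i j ≡ -1ℤ))

OrthogonalSigned : ∀ {m} → Matrix m → Set
OrthogonalSigned {m} C =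
  Signed C × ∃ λ (α : ℤ) → (α > 0ℤ) × ((∀ i j → (C · transpose C) i j ≡ (α • I) i j)
                                       × (∀ i j → (transpose C · C) i j ≡ (α • I) i j))

Symmetric : ∀ {m} → Matrix m → Set
Symmetric C = ∀ i j → C i j ≡ C j i

ZeroDiagonal : ∀ {m} → Matrix m → Set
ZeroDiagonal C = ∀ i → C i i ≡ 0ℤ

block : ∀ {n} → Matrix n → Matrix n → Matrix n → Matrix n → Fin 4 → Fin 4 → Matrix n
block A₁ A₂ A₃ A₄ zero zero = A₁
block A₁ A₂ A₃ A₄ zero (suc zero) = A₂
block A₁ A₂ A₃ A₄ zero (suc (suc zero)) = A₃
block A₁ A₂ A₃ A₄ zero (suc (suc (suc zero))) = A₄
block A₁ A₂ A₃ A₄ (suc zero) zero = neg A₂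
block A₁ A₂ A₃ A₄ (suc zero) (suc zero) = A₁
block A₁ A₂ A₃ A₄ (suc zero) (suc (suc zero)) = neg A₄
block A₁ A₂ A₃ A₄ (suc zero) (suc (suc (suc zero))) = A₃
block A₁ A₂ A₃ A₄ (suc (suc zero)) zero = neg A₃
block A₁ A₂ A₃ A₄ (suc (suc zero)) (suc zero) = A₄
block A₁ A₂ A₃ A₄ (suc (suc zero)) (suc (suc zero)) = A₁
block A₁ A₂ A₃ A₄ (suc (suc zero)) (suc (suc (suc zero))) = neg A₂
block A₁ A₂ A₃ A₄ (suc (suc (suc zero))) zero = neg A₄
block A₁ A₂ A₃ A₄ (suc (suc (suc zero))) (suc zero) = neg A₃
block A₁ A₂ A₃ A₄ (suc (suc (suc zero))) (suc (suc zero)) = A₂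
block A₁ A₂ A₃ A₄ (suc (suc (suc zero))) (suc (suc (suc zero))) = A₁

-- the 4n × 4n matrix H; index i ∈ Fin (4 * n) corresponds to (block row, row within block)
-- via remQuot (i = blockIndex * n + innerIndex)
Hmat : ∀ {n} → Matrix n → Matrix n → Matrix n → Matrix n → Matrix (4 ℕ.* n)
Hmat {n} A₁ A₂ A₃ A₄ i j with remQuot {4} n i | remQuot {4} n j
... | (r , a) | (s , b) = block A₁ A₂ A₃ A₄ r s a b

data Choice {n : ℕ} (C : Matrix n) : Matrix n → Matrix n → Matrix n → Matrix n → Set where
  case-i   : Choice C C C C C
  case-ii  : ZeroDiagonal C → Choice C C C (C ⊖ I) (C ⊕ I)
  case-iii : ZeroDiagonal C → Choice C (C ⊕ I) (C ⊕ I) (C ⊖ I) (C ⊖ I)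

-- Write Aₖ = C + lₖ I; in the three cases the shifts l = (0,0,0,0), (0,0,-1,1), (1,1,-1,-1) sum to 0.
-- As C is symmetric with C Cᵀ = α I, Aᵢ Aⱼᵀ = (α + lᵢ lⱼ) I + (lᵢ + lⱼ) C is symmetric in i and j,
-- and Σₖ Aₖ Aₖᵀ = (4α + Σₖ lₖ²) I.  Indexing the blocks by the Klein four-group, block (r, s) of H is
-- ± A_{r ⊻ s}.  For block rows r ≠ s the products at positions t and r ⊻ s ⊻ t involve the same two
-- matrices with opposite signs and cancel, so H Hᵀ = (4α + Σₖ lₖ²) I; the block columns behave the
-- same way since the Aₖ are symmetric.

module Submission where

open import Data.Fin using (Fin; zero; suc; _≟_; _↑ˡ_; _↑ʳ_; combine; remQuot)
open import Data.Fin.Patterns using (0F; 1F; 2F; 3F)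
open import Data.Fin.Permutation using (Permutation; permutation)
open import Data.Fin.Properties using (all?; combine-injective; combine-remQuot; remQuot-combine)
open import Data.Integer using (ℤ; -_; _+_; _-_; _*_; 0ℤ; 1ℤ; -1ℤ; _<_; _≤_; _>_; +≤+; sign; ∣_∣)
import Data.Integer as ℤ
open import Data.Integer.Properties
  using (+-*-semiring; *-commutativeSemigroup; +-identityˡ; +-identityʳ; +-assoc; +-comm;
         *-identityˡ; *-identityʳ; *-zeroʳ; *-comm; *-assoc; -1*i≡-i; neg-distribˡ-*;
         +-mono-≤; +-mono-<-≤; <⇒≤; +◃n≡+n)
open import Data.Integer.Tactic.RingSolver using (solve-∀)
open import Data.Nat using (ℕ; zero; suc; z≤n)
import Data.Nat as ℕ
open import Data.Product using (_×_; _,_; proj₁; proj₂)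
open import Data.Sign.Properties using (s*s≡+)
open import Data.Sum using (_⊎_; inj₁; inj₂)
open import Data.Vec.Functional using ([]; _∷_)
open import Function using (_∘_; flip)
open import Relation.Binary.PropositionalEquality
open import Relation.Nullary.Decidable using (Dec; yes; no; from-yes; ¬?; _→-dec_; _×-dec_; _⊎-dec_)
open import Relation.Nullary.Negation using (contradiction)
open import Defs

open import Algebra.Properties.CommutativeSemigroup *-commutativeSemigroup using (interchange)
open import Algebra.Properties.Semiring.Sum +-*-semiring
  using (sum; sum-replicate-zero; ∑-distrib-+; *-distribˡ-sum; *-distribʳ-sum; ∑-permute)
open ≡-Reasoning

Σ-cong : ∀ m {f g : Fin m → ℤ} → (∀ i → f i ≡ g i) → Σ m f ≡ Σ m g
Σ-cong zero    _   = refl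
Σ-cong (suc m) f≗g = cong₂ _+_ (f≗g zero) (Σ-cong m (f≗g ∘ suc))

Σ≡sum : ∀ m (f : Fin m → ℤ) → Σ m f ≡ sum f
Σ≡sum zero    f = refl
Σ≡sum (suc m) f = cong (f zero +_) (Σ≡sum m (f ∘ suc))

Σ-zero : ∀ m → Σ m (λ _ → 0ℤ) ≡ 0ℤ
Σ-zero m = trans (Σ≡sum m _) (sum-replicate-zero m)

Σ-distrib-+ : ∀ m (f g : Fin m → ℤ) → Σ m (λ i → f i + g i) ≡ Σ m f + Σ m g
Σ-distrib-+ m f g = begin
  Σ m (λ i → f i + g i) ≡⟨ Σ≡sum m _ ⟩
  sum (λ i → f i + g i) ≡⟨ ∑-distrib-+ f g ⟩
  sum f + sum g         ≡⟨ cong₂ _+_ (Σ≡sum m f) (Σ≡sum m g) ⟨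
  Σ m f + Σ m g         ∎

*-distribˡ-Σ : ∀ m k (f : Fin m → ℤ) → k * Σ m f ≡ Σ m (λ i → k * f i)
*-distribˡ-Σ m k f = begin
  k * Σ m f             ≡⟨ cong (k *_) (Σ≡sum m f) ⟩
  k * sum f             ≡⟨ *-distribˡ-sum k f ⟩
  sum (λ i → k * f i)   ≡⟨ Σ≡sum m _ ⟨
  Σ m (λ i → k * f i)   ∎

*-distribʳ-Σ : ∀ m k (f : Fin m → ℤ) → Σ m f * k ≡ Σ m (λ i → f i * k)
*-distribʳ-Σ m k f = begin
  Σ m f * k             ≡⟨ cong (_* k) (Σ≡sum m f) ⟩
  sum f * k             ≡⟨ *-distribʳ-sum k f ⟩
  sum (λ i → f i * k)   ≡⟨ Σ≡sum m _ ⟨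
  Σ m (λ i → f i * k)   ∎

neg-distrib-Σ : ∀ m (f : Fin m → ℤ) → - Σ m f ≡ Σ m (λ i → - f i)
neg-distrib-Σ m f = begin
  - Σ m f                  ≡⟨ -1*i≡-i _ ⟨
  -1ℤ * Σ m f              ≡⟨ *-distribˡ-Σ m -1ℤ f ⟩
  Σ m (λ i → -1ℤ * f i)    ≡⟨ Σ-cong m (λ i → -1*i≡-i (f i)) ⟩
  Σ m (λ i → - f i)        ∎

Σ-nonneg : ∀ m {f : Fin m → ℤ} → (∀ i → 0ℤ ≤ f i) → 0ℤ ≤ Σ m f
Σ-nonneg zero    _   = +≤+ z≤n
Σ-nonneg (suc m) f≥0 = +-mono-≤ (f≥0 zero) (Σ-nonneg m (f≥0 ∘ suc))

Σ-positive : ∀ m {f : Fin (suc m) → ℤ} → (∀ i → 0ℤ < f i) → 0ℤ < Σ (suc m) f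
Σ-positive m f>0 = +-mono-<-≤ (f>0 zero) (Σ-nonneg m (<⇒≤ ∘ f>0 ∘ suc))

Σ-↑ : ∀ m k (f : Fin (m ℕ.+ k) → ℤ) → Σ (m ℕ.+ k) f ≡ Σ m (λ i → f (i ↑ˡ k)) + Σ k (λ j → f (m ↑ʳ j))
Σ-↑ zero    k f = sym (+-identityˡ _)
Σ-↑ (suc m) k f = begin
  f zero + Σ (m ℕ.+ k) (f ∘ suc)                                     ≡⟨ cong (f zero +_) (Σ-↑ m k (f ∘ suc)) ⟩
  f zero + (Σ m (λ i → f (suc i ↑ˡ k)) + Σ k (λ j → f (suc m ↑ʳ j))) ≡⟨ +-assoc (f zero) _ _ ⟨
  f zero + Σ m (λ i → f (suc i ↑ˡ k)) + Σ k (λ j → f (suc m ↑ʳ j))   ∎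

Σ-combine : ∀ m n (f : Fin (m ℕ.* n) → ℤ) → Σ (m ℕ.* n) f ≡ Σ m (λ r → Σ n (λ c → f (combine r c)))
Σ-combine zero    n f = refl
Σ-combine (suc m) n f =
  trans (Σ-↑ n (m ℕ.* n) f) (cong (Σ n (λ c → f (c ↑ˡ (m ℕ.* n))) +_) (Σ-combine m n (f ∘ (n ↑ʳ_))))

δ-refl : ∀ {m} (a : Fin m) → δ a a ≡ 1ℤ
δ-refl zero    = refl
δ-refl (suc a) = δ-refl a

δ-≢ : ∀ {m} {a b : Fin m} → a ≢ b → δ a b ≡ 0ℤ
δ-≢ {a = zero}  {zero}  a≢b = contradiction refl a≢b
δ-≢ {a = zero}  {suc b} _   = refl
δ-≢ {a = suc a} {zero}  _   = refl
δ-≢ {a = suc a} {suc b} a≢b = δ-≢ (a≢b ∘ cong suc)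

δ-sym : ∀ {m} (a b : Fin m) → δ a b ≡ δ b a
δ-sym zero    zero    = refl
δ-sym zero    (suc b) = refl
δ-sym (suc a) zero    = refl
δ-sym (suc a) (suc b) = δ-sym a b

δ-combine : ∀ {m n} (r s : Fin m) (a b : Fin n) → δ (combine r a) (combine s b) ≡ δ r s * δ a b
δ-combine r s a b with r ≟ s | a ≟ b
... | yes refl | yes refl = trans (δ-refl (combine r a)) (sym (cong₂ _*_ (δ-refl r) (δ-refl a)))
... | no r≢s   | _        = trans (δ-≢ (r≢s ∘ proj₁ ∘ combine-injective r a s b)) (cong (_* δ a b) (sym (δ-≢ r≢s)))
... | yes refl | no a≢b   =
  trans (δ-≢ (a≢b ∘ proj₂ ∘ combine-injective r a r b)) (sym (trans (cong (δ r r *_) (δ-≢ a≢b)) (*-zeroʳ (δ r r))))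

Σ-select : ∀ m (f : Fin m → ℤ) b → Σ m (λ c → f c * δ b c) ≡ f b
Σ-select (suc m) f zero = begin
  f zero * 1ℤ + Σ m (λ c → f (suc c) * 0ℤ) ≡⟨ cong₂ _+_ (*-identityʳ (f zero)) (Σ-cong m (*-zeroʳ ∘ f ∘ suc)) ⟩
  f zero + Σ m (λ _ → 0ℤ)                 ≡⟨ cong (f zero +_) (Σ-zero m) ⟩
  f zero + 0ℤ                             ≡⟨ +-identityʳ _ ⟩
  f zero                                  ∎
Σ-select (suc m) f (suc b) = begin
  f zero * 0ℤ + Σ m (λ c → f (suc c) * δ b c) ≡⟨ cong (_+ Σ m (λ c → f (suc c) * δ b c)) (*-zeroʳ (f zero)) ⟩
  0ℤ + Σ m (λ c → f (suc c) * δ b c)          ≡⟨ +-identityˡ _ ⟩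
  Σ m (λ c → f (suc c) * δ b c)               ≡⟨ Σ-select m (f ∘ suc) b ⟩
  f (suc b)                                   ∎

blockOf : ∀ {m n} → Matrix (m ℕ.* n) → Fin m → Fin m → Matrix n
blockOf P r s a b = P (combine r a) (combine s b)

blockwise : ∀ {m n} {P Q : Matrix (m ℕ.* n)} →
  (∀ r s a b → blockOf P r s a b ≡ blockOf Q r s a b) → ∀ i j → P i j ≡ Q i j
blockwise {m} {n} {P} {Q} P≐Q i j =
  subst₂ (λ i j → P i j ≡ Q i j) (combine-remQuot {m} n i) (combine-remQuot {m} n j)
    (P≐Q (proj₁ (remQuot {m} n i)) (proj₁ (remQuot {m} n j)) (proj₂ (remQuot {m} n i)) (proj₂ (remQuot {m} n j)))

·-blockOf : ∀ {m n} (P Q : Matrix (m ℕ.* n)) r s a b →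
  blockOf (P · Q) r s a b ≡ Σ m (λ t → (blockOf P r t · blockOf Q t s) a b)
·-blockOf {m} {n} P Q r s a b = Σ-combine m n (λ k → P (combine r a) k * Q k (combine s b))

blockOf-scalarI : ∀ {m n} β r s (a b : Fin n) → blockOf {m} (β • I) r s a b ≡ δ r s * (β • I) a b
blockOf-scalarI β r s a b = begin
  β * δ (combine r a) (combine s b) ≡⟨ cong (β *_) (δ-combine r s a b) ⟩
  β * (δ r s * δ a b)               ≡⟨ *-assoc β _ _ ⟨
  β * δ r s * δ a b                 ≡⟨ cong (_* δ a b) (*-comm β (δ r s)) ⟩
  δ r s * β * δ a b                 ≡⟨ *-assoc (δ r s) β _ ⟩
  δ r s * (β * δ a b)               ∎

i≡-i⇒i≡0 : ∀ {i} → i ≡ - i → i ≡ 0ℤ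
i≡-i⇒i≡0 {ℤ.+ zero}  _  = refl
i≡-i⇒i≡0 {ℤ.+ suc n} ()
i≡-i⇒i≡0 {ℤ.-[1+ n ]} ()

0≤i*i : ∀ i → 0ℤ ≤ i * i
0≤i*i i rewrite s*s≡+ (sign i) | +◃n≡+n (∣ i ∣ ℕ.* ∣ i ∣) = +≤+ z≤n

-- The Klein four-group ℤ₂ × ℤ₂ on Fin 4 (bitwise xor of the two-bit codes).
infixl 7 _⊻_
_⊻_ : Fin 4 → Fin 4 → Fin 4
0F ⊻ t  = t
1F ⊻ 0F = 1F
1F ⊻ 1F = 0F
1F ⊻ 2F = 3F
1F ⊻ 3F = 2F
2F ⊻ 0F = 2F
2F ⊻ 1F = 3F
2F ⊻ 2F = 0F
2F ⊻ 3F = 1F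
3F ⊻ 0F = 3F
3F ⊻ 1F = 2F
3F ⊻ 2F = 1F
3F ⊻ 3F = 0F

⊻-comm : ∀ r t → r ⊻ t ≡ t ⊻ r
⊻-comm = from-yes (all? λ r → all? λ t → r ⊻ t ≟ t ⊻ r)

⊻-cancelˡ : ∀ d t → d ⊻ (d ⊻ t) ≡ t
⊻-cancelˡ = from-yes (all? λ d → all? λ t → d ⊻ (d ⊻ t) ≟ t)

⊻-swap : ∀ r s t → r ⊻ (r ⊻ s ⊻ t) ≡ s ⊻ t
⊻-swap = from-yes (all? λ r → all? λ s → all? λ t → r ⊻ (r ⊻ s ⊻ t) ≟ s ⊻ t)

⊻-permutation : Fin 4 → Permutation 4 4
⊻-permutation d = permutation (d ⊻_) (d ⊻_) (⊻-cancelˡ d) (⊻-cancelˡ d)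

Σ-⊻ : ∀ d (g : Fin 4 → ℤ) → Σ 4 (λ t → g (d ⊻ t)) ≡ Σ 4 g
-- For a numeral length, Σ and the library's sum unfold to the same term.
Σ-⊻ d g = sym (∑-permute g (⊻-permutation d))

Σ-odd : ∀ d (g : Fin 4 → ℤ) → (∀ t → g (d ⊻ t) ≡ - g t) → Σ 4 g ≡ 0ℤ
Σ-odd d g g-odd = i≡-i⇒i≡0 (begin
  Σ 4 g                    ≡⟨ Σ-⊻ d g ⟨
  Σ 4 (λ t → g (d ⊻ t))    ≡⟨ Σ-cong 4 g-odd ⟩
  Σ 4 (λ t → - g t)        ≡⟨ neg-distrib-Σ 4 g ⟨
  - Σ 4 g                  ∎)

OrthogonalSignPattern : (Fin 4 → Fin 4 → ℤ) → Set
OrthogonalSignPattern ε =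
  (∀ r t → ε r t * ε r t ≡ 1ℤ) ×
  (∀ r s t → r ≢ s → ε r (r ⊻ s ⊻ t) * ε s (r ⊻ s ⊻ t) ≡ - (ε r t * ε s t))

orthogonalSignPattern? : ∀ ε → Dec (OrthogonalSignPattern ε)
orthogonalSignPattern? ε =
  (all? λ r → all? λ t → ε r t * ε r t ℤ.≟ 1ℤ) ×-dec
  (all? λ r → all? λ s → all? λ t →
    ¬? (r ≟ s) →-dec (ε r (r ⊻ s ⊻ t) * ε s (r ⊻ s ⊻ t) ℤ.≟ - (ε r t * ε s t)))

orthogonal-design : ∀ ε → OrthogonalSignPattern ε → (x : Fin 4 → Fin 4 → ℤ) → (∀ i j → x i j ≡ x j i) →
  ∀ r s → Σ 4 (λ t → ε r t * ε s t * x (r ⊻ t) (s ⊻ t)) ≡ δ r s * Σ 4 (λ i → x i i)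
orthogonal-design ε (unit , cancel) x x-sym r s with r ≟ s
... | yes refl = begin
  Σ 4 (λ t → ε r t * ε r t * x (r ⊻ t) (r ⊻ t))
    ≡⟨ Σ-cong 4 (λ t → trans (cong (_* x (r ⊻ t) (r ⊻ t)) (unit r t)) (*-identityˡ _)) ⟩
  Σ 4 (λ t → x (r ⊻ t) (r ⊻ t))                 ≡⟨ Σ-⊻ r (λ i → x i i) ⟩
  Σ 4 (λ i → x i i)                             ≡⟨ *-identityˡ _ ⟨
  1ℤ * Σ 4 (λ i → x i i)                        ≡⟨ cong (_* Σ 4 (λ i → x i i)) (δ-refl r) ⟨
  δ r r * Σ 4 (λ i → x i i)                     ∎
... | no r≢s = trans (Σ-odd (r ⊻ s) g g-odd) (cong (_* Σ 4 (λ i → x i i)) (sym (δ-≢ r≢s)))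
  where
  g : Fin 4 → ℤ
  g t = ε r t * ε s t * x (r ⊻ t) (s ⊻ t)

  g-odd : ∀ t → g (r ⊻ s ⊻ t) ≡ - g t
  g-odd t = begin
    ε r t′ * ε s t′ * x (r ⊻ t′) (s ⊻ t′)
      ≡⟨ cong₂ _*_ (cancel r s t r≢s) (cong₂ x (⊻-swap r s t) s⊻t′≡r⊻t) ⟩
    - (ε r t * ε s t) * x (s ⊻ t) (r ⊻ t)  ≡⟨ cong (- (ε r t * ε s t) *_) (x-sym (s ⊻ t) (r ⊻ t)) ⟩
    - (ε r t * ε s t) * x (r ⊻ t) (s ⊻ t)  ≡⟨ neg-distribˡ-* (ε r t * ε s t) _ ⟨
    - g t                                  ∎
    where
    t′ = r ⊻ s ⊻ t
    s⊻t′≡r⊻t : s ⊻ t′ ≡ r ⊻ t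
    s⊻t′≡r⊻t = trans (cong (λ d → s ⊻ (d ⊻ t)) (⊻-comm r s)) (⊻-swap s r t)

σ : Fin 4 → Fin 4 → ℤ
σ 0F _  = 1ℤ
σ 1F 1F = 1ℤ
σ 1F 3F = 1ℤ
σ 2F 1F = 1ℤ
σ 2F 2F = 1ℤ
σ 3F 2F = 1ℤ
σ 3F 3F = 1ℤ
σ _  _  = -1ℤ

σ-±1 : ∀ r t → σ r t ≡ 1ℤ ⊎ σ r t ≡ -1ℤ
σ-±1 = from-yes (all? λ r → all? λ t → (σ r t ℤ.≟ 1ℤ) ⊎-dec (σ r t ℤ.≟ -1ℤ))

σ-orthogonal : OrthogonalSignPattern σ
σ-orthogonal = from-yes (orthogonalSignPattern? σ)

σᵀ-orthogonal : OrthogonalSignPattern (flip σ)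
σᵀ-orthogonal = from-yes (orthogonalSignPattern? (flip σ))

SignedEntry : ℤ → Set
SignedEntry x = x ≡ 0ℤ ⊎ x ≡ 1ℤ ⊎ x ≡ -1ℤ

signed-neg : ∀ {x} → SignedEntry x → SignedEntry (- x)
signed-neg (inj₁ refl)        = inj₁ refl
signed-neg (inj₂ (inj₁ refl)) = inj₂ (inj₂ refl)
signed-neg (inj₂ (inj₂ refl)) = inj₂ (inj₁ refl)

signed-±1* : ∀ {e x} → e ≡ 1ℤ ⊎ e ≡ -1ℤ → SignedEntry x → SignedEntry (e * x)
signed-±1* (inj₁ refl) x-signed = subst SignedEntry (sym (*-identityˡ _)) x-signed
signed-±1* (inj₂ refl) x-signed = subst SignedEntry (sym (-1*i≡-i _)) (signed-neg x-signed)

Amicable : ∀ {n} → Matrix n → Matrix n → Set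
Amicable X Y = ∀ a b → (X · transpose Y) a b ≡ (Y · transpose X) a b

GramSum : ∀ {m n} → ℤ → (Fin m → Matrix n) → Set
GramSum {m} β X = ∀ a b → Σ m (λ i → (X i · transpose (X i)) a b) ≡ (β • I) a b

·-scaled : ∀ {n} {P Q X Y : Matrix n} x y → (∀ a c → P a c ≡ x * X a c) → (∀ b c → Q b c ≡ y * Y b c) →
  ∀ a b → (P · transpose Q) a b ≡ x * y * (X · transpose Y) a b
·-scaled {n} {P} {Q} {X} {Y} x y P≐xX Q≐yY a b = begin
  Σ n (λ c → P a c * Q b c)             ≡⟨ Σ-cong n (λ c → cong₂ _*_ (P≐xX a c) (Q≐yY b c)) ⟩
  Σ n (λ c → x * X a c * (y * Y b c))   ≡⟨ Σ-cong n (λ c → interchange x (X a c) y (Y b c)) ⟩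
  Σ n (λ c → x * y * (X a c * Y b c))   ≡⟨ *-distribˡ-Σ n (x * y) _ ⟨
  x * y * Σ n (λ c → X a c * Y b c)     ∎

signed-array-orthogonal : ∀ {n} ε β {S : Fin 4 → Fin 4 → Matrix n} {X : Fin 4 → Matrix n} →
  OrthogonalSignPattern ε → (∀ r t a c → S r t a c ≡ ε r t * X (r ⊻ t) a c) →
  (∀ i j → Amicable (X i) (X j)) → GramSum β X →
  ∀ r s a b → Σ 4 (λ t → (S r t · transpose (S s t)) a b) ≡ δ r s * (β • I) a b
signed-array-orthogonal ε β {S} {X} ε-orthogonal S≐εX amicable gramSum r s a b = begin
  Σ 4 (λ t → (S r t · transpose (S s t)) a b)
    ≡⟨ Σ-cong 4 (λ t → ·-scaled (ε r t) (ε s t) (S≐εX r t) (S≐εX s t) a b) ⟩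
  Σ 4 (λ t → ε r t * ε s t * (X (r ⊻ t) · transpose (X (s ⊻ t))) a b)
    ≡⟨ orthogonal-design ε ε-orthogonal (λ i j → (X i · transpose (X j)) a b) (λ i j → amicable i j a b) r s ⟩
  δ r s * Σ 4 (λ i → (X i · transpose (X i)) a b)
    ≡⟨ cong (δ r s *_) (gramSum a b) ⟩
  δ r s * (β • I) a b
    ∎

module _ {n} (A₁ A₂ A₃ A₄ : Matrix n) where
  private
    A = A₁ ∷ A₂ ∷ A₃ ∷ A₄ ∷ []
    H = Hmat A₁ A₂ A₃ A₄

  block-sign : ∀ r t a c → block A₁ A₂ A₃ A₄ r t a c ≡ σ r t * A (r ⊻ t) a c
  block-sign 0F 0F a c = sym (*-identityˡ _)
  block-sign 0F 1F a c = sym (*-identityˡ _)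
  block-sign 0F 2F a c = sym (*-identityˡ _)
  block-sign 0F 3F a c = sym (*-identityˡ _)
  block-sign 1F 0F a c = sym (-1*i≡-i _)
  block-sign 1F 1F a c = sym (*-identityˡ _)
  block-sign 1F 2F a c = sym (-1*i≡-i _)
  block-sign 1F 3F a c = sym (*-identityˡ _)
  block-sign 2F 0F a c = sym (-1*i≡-i _)
  block-sign 2F 1F a c = sym (*-identityˡ _)
  block-sign 2F 2F a c = sym (*-identityˡ _)
  block-sign 2F 3F a c = sym (-1*i≡-i _)
  block-sign 3F 0F a c = sym (-1*i≡-i _)
  block-sign 3F 1F a c = sym (-1*i≡-i _)
  block-sign 3F 2F a c = sym (*-identityˡ _)
  block-sign 3F 3F a c = sym (*-identityˡ _)

  blockOf-Hmat : ∀ r s a b → blockOf H r s a b ≡ block A₁ A₂ A₃ A₄ r s a b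
  blockOf-Hmat r s a b = cong₂ (λ p q → block A₁ A₂ A₃ A₄ (proj₁ p) (proj₁ q) (proj₂ p) (proj₂ q))
                               (remQuot-combine r a) (remQuot-combine s b)

  Hmat-signed : (∀ k → Signed (A k)) → Signed H
  Hmat-signed A-signed i j =
    subst SignedEntry (sym (block-sign r s a b)) (signed-±1* (σ-±1 r s) (A-signed (r ⊻ s) a b))
    where
    r = proj₁ (remQuot {4} n i)
    a = proj₂ (remQuot {4} n i)
    s = proj₁ (remQuot {4} n j)
    b = proj₂ (remQuot {4} n j)

  Hmat-rows : ∀ β → (∀ i j → Amicable (A i) (A j)) → GramSum β A →
    ∀ i j → (H · transpose H) i j ≡ (β • I) i j
  Hmat-rows β amicable gramSum = blockwise λ r s a b → begin
    blockOf (H · transpose H) r s a b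
      ≡⟨ ·-blockOf H (transpose H) r s a b ⟩
    Σ 4 (λ t → (blockOf H r t · transpose (blockOf H s t)) a b)
      ≡⟨ signed-array-orthogonal σ β {blockOf H} {A} σ-orthogonal H-blocks amicable gramSum r s a b ⟩
    δ r s * (β • I) a b
      ≡⟨ blockOf-scalarI β r s a b ⟨
    blockOf (β • I) r s a b
      ∎
    where
    H-blocks : ∀ r t a c → blockOf H r t a c ≡ σ r t * A (r ⊻ t) a c
    H-blocks r t a c = trans (blockOf-Hmat r t a c) (block-sign r t a c)

  Hmat-columns : ∀ β → (∀ i j → Amicable (transpose (A i)) (transpose (A j))) → GramSum β (transpose ∘ A) →
    ∀ i j → (transpose H · H) i j ≡ (β • I) i j
  Hmat-columns β amicable gramSum = blockwise λ r s a b → begin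
    blockOf (transpose H · H) r s a b
      ≡⟨ ·-blockOf (transpose H) H r s a b ⟩
    Σ 4 (λ t → (blockOf (transpose H) r t · transpose (blockOf (transpose H) s t)) a b)
      ≡⟨ signed-array-orthogonal (flip σ) β {blockOf (transpose H)} {transpose ∘ A}
           σᵀ-orthogonal Hᵀ-blocks amicable gramSum r s a b ⟩
    δ r s * (β • I) a b
      ≡⟨ blockOf-scalarI β r s a b ⟨
    blockOf (β • I) r s a b
      ∎
    where
    Hᵀ-blocks : ∀ r t a c → blockOf (transpose H) r t a c ≡ flip σ r t * transpose (A (r ⊻ t)) a c
    Hᵀ-blocks r t a c = begin
      blockOf H t r c a        ≡⟨ blockOf-Hmat t r c a ⟩
      block A₁ A₂ A₃ A₄ t r c a ≡⟨ block-sign t r c a ⟩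
      σ t r * A (t ⊻ r) c a    ≡⟨ cong (λ k → σ t r * A k c a) (⊻-comm t r) ⟩
      σ t r * A (r ⊻ t) c a    ∎

  Hmat-orthogonalSigned : ∀ β → (∀ k → Signed (A k)) → β > 0ℤ →
    (∀ i j → Amicable (A i) (A j)) → GramSum β A →
    (∀ i j → Amicable (transpose (A i)) (transpose (A j))) → GramSum β (transpose ∘ A) →
    OrthogonalSigned H
  Hmat-orthogonalSigned β A-signed β>0 rows-amicable rows-gramSum columns-amicable columns-gramSum =
    Hmat-signed A-signed , β , β>0 ,
    Hmat-rows β rows-amicable rows-gramSum , Hmat-columns β columns-amicable columns-gramSum

IsShift : ∀ {n} → Matrix n → ℤ → Matrix n → Set
IsShift C u X = ∀ a c → X a c ≡ C a c + u * δ a c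

transpose-shift : ∀ {n} {C X : Matrix n} → Symmetric C → ∀ u → IsShift C u X → IsShift C u (transpose X)
transpose-shift C-symmetric u X≐ a c = trans (X≐ c a) (cong₂ (λ x d → x + u * d) (C-symmetric c a) (δ-sym c a))

module Shifts {n} {C : Matrix n} {α : ℤ} (C-symmetric : Symmetric C)
              (CCᵀ : ∀ a b → (C · transpose C) a b ≡ (α • I) a b) where

  shift-gram : ∀ u v {X Y} → IsShift C u X → IsShift C v Y →
    ∀ a b → (X · transpose Y) a b ≡ (α + u * v) * δ a b + (u + v) * C a b
  shift-gram u v {X} {Y} X≐ Y≐ a b = begin
    Σ n (λ c → X a c * Y b c)
      ≡⟨ Σ-cong n (λ c → trans (cong₂ _*_ (X≐ a c) (Y≐ b c)) (expand u v (C a c) (C b c) (δ a c) (δ b c))) ⟩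
    Σ n (λ c → CC c + (vCδ c + (uCδ c + uvδδ c)))
      ≡⟨ Σ-distrib-+ n CC _ ⟩
    Σ n CC + Σ n (λ c → vCδ c + (uCδ c + uvδδ c))
      ≡⟨ cong (Σ n CC +_) (trans (Σ-distrib-+ n vCδ _) (cong (Σ n vCδ +_) (Σ-distrib-+ n uCδ uvδδ))) ⟩
    Σ n CC + (Σ n vCδ + (Σ n uCδ + Σ n uvδδ))
      ≡⟨ cong₂ _+_ (CCᵀ a b) (cong₂ _+_ (scaled-select v (C a) b)
                              (cong₂ _+_ (trans (scaled-select u (C b) a) (cong (u *_) (C-symmetric b a)))
                                         (scaled-select (u * v) (δ a) b))) ⟩
    α * δ a b + (v * C a b + (u * C a b + u * v * δ a b))
      ≡⟨ collect α u v (δ a b) (C a b) ⟩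
    (α + u * v) * δ a b + (u + v) * C a b
      ∎
    where
    CC vCδ uCδ uvδδ : Fin n → ℤ
    CC   c = C a c * C b c
    vCδ  c = v * (C a c * δ b c)
    uCδ  c = u * (C b c * δ a c)
    uvδδ c = u * v * (δ a c * δ b c)

    expand : ∀ u v x y d e → (x + u * d) * (y + v * e) ≡ x * y + (v * (x * e) + (u * (y * d) + u * v * (d * e)))
    expand = solve-∀

    collect : ∀ α u v d x → α * d + (v * x + (u * x + u * v * d)) ≡ (α + u * v) * d + (u + v) * x
    collect = solve-∀

    scaled-select : ∀ k (f : Fin n → ℤ) b → Σ n (λ c → k * (f c * δ b c)) ≡ k * f b
    scaled-select k f b = trans (sym (*-distribˡ-Σ n k _)) (cong (k *_) (Σ-select n f b))

  module _ {m} (l : Fin m → ℤ) {X : Fin m → Matrix n} (X-shifted : ∀ k → IsShift C (l k) (X k)) where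

    shifts-amicable : ∀ i j → Amicable (X i) (X j)
    shifts-amicable i j a b = begin
      (X i · transpose (X j)) a b                       ≡⟨ shift-gram (l i) (l j) (X-shifted i) (X-shifted j) a b ⟩
      (α + l i * l j) * δ a b + (l i + l j) * C a b
        ≡⟨ cong₂ (λ p q → (α + p) * δ a b + q * C a b) (*-comm (l i) (l j)) (+-comm (l i) (l j)) ⟩
      (α + l j * l i) * δ a b + (l j + l i) * C a b     ≡⟨ shift-gram (l j) (l i) (X-shifted j) (X-shifted i) a b ⟨
      (X j · transpose (X i)) a b                       ∎

    shifts-gramSum : Σ m l ≡ 0ℤ → GramSum (Σ m (λ k → α + l k * l k)) X
    shifts-gramSum Σl≡0 a b = begin
      Σ m (λ k → (X k · transpose (X k)) a b)
        ≡⟨ Σ-cong m (λ k → shift-gram (l k) (l k) (X-shifted k) (X-shifted k) a b) ⟩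
      Σ m (λ k → (α + l k * l k) * δ a b + (l k + l k) * C a b)
        ≡⟨ Σ-distrib-+ m (λ k → (α + l k * l k) * δ a b) (λ k → (l k + l k) * C a b) ⟩
      Σ m (λ k → (α + l k * l k) * δ a b) + Σ m (λ k → (l k + l k) * C a b)
        ≡⟨ cong₂ _+_ (*-distribʳ-Σ m (δ a b) (λ k → α + l k * l k)) (*-distribʳ-Σ m (C a b) (λ k → l k + l k)) ⟨
      Σ m (λ k → α + l k * l k) * δ a b + Σ m (λ k → l k + l k) * C a b
        ≡⟨ cong (λ x → Σ m (λ k → α + l k * l k) * δ a b + x * C a b)
                (trans (Σ-distrib-+ m l l) (cong₂ _+_ Σl≡0 Σl≡0)) ⟩
      Σ m (λ k → α + l k * l k) * δ a b + 0ℤ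
        ≡⟨ +-identityʳ _ ⟩
      Σ m (λ k → α + l k * l k) * δ a b
        ∎

C-isShift : ∀ {n} (C : Matrix n) → IsShift C 0ℤ C
C-isShift C a c = sym (+-identityʳ (C a c))

⊕I-isShift : ∀ {n} (C : Matrix n) → IsShift C 1ℤ (C ⊕ I)
⊕I-isShift C a c = cong (C a c +_) (sym (*-identityˡ (δ a c)))

⊖I-isShift : ∀ {n} (C : Matrix n) → IsShift C -1ℤ (C ⊖ I)
⊖I-isShift C a c = cong (C a c +_) (sym (-1*i≡-i (δ a c)))

⊕I-signed : ∀ {n} {C : Matrix n} → Signed C → ZeroDiagonal C → Signed (C ⊕ I)
⊕I-signed {C = C} C-signed zero-diagonal a c with a ≟ c
... | yes refl = inj₂ (inj₁ (cong₂ _+_ (zero-diagonal a) (δ-refl a)))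
... | no a≢c   =
  subst SignedEntry (sym (trans (cong (C a c +_) (δ-≢ a≢c)) (+-identityʳ (C a c)))) (C-signed a c)

⊖I-signed : ∀ {n} {C : Matrix n} → Signed C → ZeroDiagonal C → Signed (C ⊖ I)
⊖I-signed {C = C} C-signed zero-diagonal a c with a ≟ c
... | yes refl = inj₂ (inj₂ (cong₂ _-_ (zero-diagonal a) (δ-refl a)))
... | no a≢c   =
  subst SignedEntry (sym (trans (cong (λ d → C a c - d) (δ-≢ a≢c)) (+-identityʳ (C a c)))) (C-signed a c)

module _ {n} {C A₁ A₂ A₃ A₄ : Matrix n} where

  choice-shifts : Choice C A₁ A₂ A₃ A₄ → Fin 4 → ℤ
  choice-shifts case-i        = 0ℤ ∷ 0ℤ ∷ 0ℤ ∷ 0ℤ ∷ []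
  choice-shifts (case-ii _)   = 0ℤ ∷ 0ℤ ∷ -1ℤ ∷ 1ℤ ∷ []
  choice-shifts (case-iii _)  = 1ℤ ∷ 1ℤ ∷ -1ℤ ∷ -1ℤ ∷ []

  Σ-choice-shifts : (choice : Choice C A₁ A₂ A₃ A₄) → Σ 4 (choice-shifts choice) ≡ 0ℤ
  Σ-choice-shifts case-i       = refl
  Σ-choice-shifts (case-ii _)  = refl
  Σ-choice-shifts (case-iii _) = refl

  choice-shifted : (choice : Choice C A₁ A₂ A₃ A₄) →
    ∀ k → IsShift C (choice-shifts choice k) ((A₁ ∷ A₂ ∷ A₃ ∷ A₄ ∷ []) k)
  choice-shifted case-i       = λ { 0F → C-isShift C ; 1F → C-isShift C ; 2F → C-isShift C ; 3F → C-isShift C }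
  choice-shifted (case-ii _)  = λ { 0F → C-isShift C ; 1F → C-isShift C ; 2F → ⊖I-isShift C ; 3F → ⊕I-isShift C }
  choice-shifted (case-iii _) = λ { 0F → ⊕I-isShift C ; 1F → ⊕I-isShift C ; 2F → ⊖I-isShift C ; 3F → ⊖I-isShift C }

  choice-signed : Signed C → Choice C A₁ A₂ A₃ A₄ → ∀ k → Signed ((A₁ ∷ A₂ ∷ A₃ ∷ A₄ ∷ []) k)
  choice-signed C± case-i       = λ { 0F → C± ; 1F → C± ; 2F → C± ; 3F → C± }
  choice-signed C± (case-ii z)  = λ { 0F → C± ; 1F → C± ; 2F → ⊖I-signed C± z ; 3F → ⊕I-signed C± z }
  choice-signed C± (case-iii z) =
    λ { 0F → ⊕I-signed C± z ; 1F → ⊕I-signed C± z ; 2F → ⊖I-signed C± z ; 3F → ⊖I-signed C± z }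

mainTheorem10 : (n : ℕ) (C A₁ A₂ A₃ A₄ : Matrix n)
    → Symmetric C → OrthogonalSigned C
    → Choice C A₁ A₂ A₃ A₄
    → OrthogonalSigned (Hmat A₁ A₂ A₃ A₄)
mainTheorem10 n C A₁ A₂ A₃ A₄ C-symmetric (C-signed , α , α>0 , CCᵀ , _) choice =
  Hmat-orthogonalSigned A₁ A₂ A₃ A₄ β (choice-signed C-signed choice) β>0
    (shifts-amicable l A-shifted) (shifts-gramSum l A-shifted (Σ-choice-shifts choice))
    (shifts-amicable l Aᵀ-shifted) (shifts-gramSum l Aᵀ-shifted (Σ-choice-shifts choice))
  where
  open Shifts {α = α} C-symmetric CCᵀ
  l = choice-shifts choice
  A-shifted = choice-shifted choice
  Aᵀ-shifted = λ k → transpose-shift C-symmetric (l k) (A-shifted k)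

  β : ℤ
  β = Σ 4 (λ k → α + l k * l k)

  β>0 : β > 0ℤ
  β>0 = Σ-positive 3 (λ k → +-mono-<-≤ α>0 (0≤i*i (l k)))
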